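{- Let $\Lambda$ be a finite set, let $\mathcal{A}$ be a point based function array over a semigroup $A$ indexed by $\Lambda$, and let $\mathcal{S}$ be a function array over a partial semigroup $S$ indexed by $\Lambda$ and based on $X$. Let $(f,g)\colon\mathcal{A}\to\gamma\mathcal{S}$ be a homomorphism, and let $v\in\gamma X$ satisfy $\lambda(f(\bullet))*\lambda(v)=\lambda(f(\bullet))$ in $\gamma S$ for each $\lambda\in\Lambda$. Then for each finite subset $F$ of $A$, each $D\in f(\bullet)$, each $E\in v$, and each coloring of $S$ with finitely many colors, there exists a basic double sequence $(x_n,y_n)$ with $x_n\in D$ and $y_n\in E$ for all $n$, on which the coloring is conjugate $F$-$\mathcal{A}$-tame.
   Context: Partial semigroup: partially defined associative operation. Function array over $S$ indexed by $\Lambda$ based on $X$: each $\lambda$ a partial function $X\to S$ such that for all $s_0,\dots,s_k\in S$ some $x$ has $s_i\lambda(x)$ defined for all $i,\lambda$; point based: $X=\{\bullet\}$. $\gamma S$: ultrafilters $\mathcal{U}$ on $S$ with $\{t: st\text{ defined}\}\in\mathcal{U}$ for all $s$, operation $B\in\mathcal{U}*\mathcal{V}$ iff $\{s:\{t: st\text{ defined}, st\in B\}\in\mathcal{V}\}\in\mathcal{U}$. $\gamma X$: ultrafilters on $X$ containing $\{x: s\lambda(x)\text{ defined}\}$ for all $s,\lambda$; $\lambda$ extends to $\gamma X\to\gamma S$ by $B\in\lambda(\mathcal{U})$ iff $\lambda^{ -1}(B)\in\mathcal{U}$, giving the total array $\gamma\mathcal{S}$. Homomorphism $(f,g)$ of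 total arrays: $f$ between base sets, $g$ semigroup homomorphism, $\lambda(f(y))=g(\lambda(y))$. A sequence $(z_n)$ in $X$ is basic if all products $\lambda_0(z_{n_0})\cdots\lambda_l(z_{n_l})$, $n_0<\dots<n_l$, are defined; a double sequence $(x_n,y_n)$ is basic if $x_0,y_0,x_1,y_1,x_2,y_2,\dots$ is basic. $\lambda,\lambda'\in\Lambda$ are conjugate if $\lambda(\bullet)=\lambda'(\bullet)$. With $\vee$ the operation of $A$, a coloring of $S$ is conjugate $F$-$\mathcal{A}$-tame on $(x_n,y_n)$ if the color of elements of the forms $\lambda_0(x_{m_0})\lambda'_0(y_{n_0})\cdots\lambda_l(x_{m_l})\lambda'_l(y_{n_l})$ and $\lambda_0(x_{m_0})\lambda'_0(y_{n_0})\cdots\lambda_{l-1}(x_{m_{l-1}})\lambda'_{l-1}(y_{n_{l-1}})\lambda_l(x_{m_l})$, where $m_0\leq n_0<m_1\leq n_1<\dots<m_l\leq n_l$ and for each $k\leq l$, $\lambda_k,\lambda'_k$ are conjugate and $\lambda_k(\bullet)\vee\cdots\vee\lambda_l(\bullet)\in F$, depends only on $\lambda_0(\bullet)\vee\cdots\vee\lambda_l(\bullet)\in A$. -}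

module Defs where

open import Level using (0ℓ)
open import Data.Nat using (ℕ; zero; suc; _≤_; _<_)
open import Data.Fin using (Fin)
open import Data.Unit using (⊤)
open import Data.Empty using (⊥)
open import Data.Product using (Σ; ∃; _×_; _,_; proj₁; proj₂)
open import Data.Sum using (_⊎_)
open import Data.List using (List; []; _∷_; map)
open import Data.List.Relation.Unary.All using (All)
open import Data.List.Relation.Unary.Linked using (Linked)
open import Data.List.Membership.Propositional using (_∈_)
open import Data.Maybe using (Maybe; just; nothing; Is-just; _>>=_)
open import Relation.Nullary using (¬_)
open import Relation.Binary.PropositionalEquality using (_≡_)
open import Algebra.Structures using (IsSemigroup)

record Ultrafilter (Y : Set) : Set₁ where
  field
    mem    : (Y → Set) → Set
    whole  : mem (λ _ → ⊤)
    proper : ¬ mem (λ _ → ⊥)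
    upward : ∀ {B C : Y → Set} → (∀ y → B y → C y) → mem B → mem C
    inter  : ∀ {B C : Y → Set} → mem B → mem C → mem (λ y → B y × C y)
    ultra  : ∀ (B : Y → Set) → mem B ⊎ mem (λ y → ¬ B y)
open Ultrafilter public

Fam : Set → Set₁
Fam Y = (Y → Set) → Set

_≐_ : ∀ {Y : Set} → Fam Y → Fam Y → Set₁
U ≐ V = ∀ B → (U B → V B) × (V B → U B)

-- Partial semigroups: (st)u = s(tu), meaning one side is defined iff
-- the other is, and then they are equal.

record PartialSemigroup : Set₁ where
  field
    Carrier : Set
    _·_     : Carrier → Carrier → Maybe Carrier
    assoc   : ∀ s t u →
      ((s · t) >>= λ st → st · u) ≡ ((t · u) >>= λ tu → s · tu)

module _ (S : PartialSemigroup) where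
  open PartialSemigroup S

  _·?_ : Carrier → Maybe Carrier → Maybe Carrier
  s ·? m = m >>= (s ·_)

  pprod : Maybe Carrier → List (Maybe Carrier) → Maybe Carrier
  pprod m [] = m
  pprod m (m' ∷ ms) = m >>= λ a → pprod m' ms >>= λ b → a · b

  record FunctionArray (Λ X : Set) : Set₁ where
    field
      lam      : Λ → X → Maybe Carrier
      adequate : ∀ k (s : Fin (suc k) → Carrier) →
                 ∃ λ x → ∀ (i : Fin (suc k)) (l : Λ) → Is-just (s i ·? lam l x)

  record γS : Set₁ where
    field
      ult  : Ultrafilter Carrier
      cofin : ∀ s → mem ult (λ t → Is-just (s · t))

  _⊛_ : Fam Carrier → Fam Carrier → Fam Carrier
  (U ⊛ V) B = U (λ s → V (λ t → Σ Carrier λ u → (s · t ≡ just u) × B u))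

  module _ {Λ X : Set} (𝒮 : FunctionArray Λ X) where
    open FunctionArray 𝒮

    record γX : Set₁ where
      field
        ult  : Ultrafilter X
        adq  : ∀ s l → mem ult (λ x → Is-just (s ·? lam l x))

    ext : Λ → Fam X → Fam Carrier
    ext l U B = U (λ x → Σ Carrier λ u → (lam l x ≡ just u) × B u)

    Basic : (ℕ → X) → Set
    Basic z = ∀ (w : Λ × ℕ) (ws : List (Λ × ℕ)) →
              Linked (λ a b → proj₂ a < proj₂ b) (w ∷ ws) →
              Is-just (pprod (term w) (map term ws))
      where
        term : Λ × ℕ → Maybe Carrier
        term (l , n) = lam l (z n)

    interleave : (ℕ → X) → (ℕ → X) → ℕ → X
    interleave x y zero = x 0
    interleave x y (suc zero) = y 0
    interleave x y (suc (suc k)) = interleave (λ n → x (suc n)) (λ n → y (suc n)) k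

    BasicDouble : (ℕ → X) → (ℕ → X) → Set
    BasicDouble x y = Basic (interleave x y)

    -- Conjugate F-𝒜-tameness.  A : semigroup (A, _∨_), point based array
    -- over A indexed by Λ given by α l = l(•).

    -- a block λ_k(x_{m_k}) λ'_k(y_{n_k})
    record Block : Set where
      constructor blk
      field
        l l' : Λ
        m n  : ℕ

    -- last part: either λ_l(x_{m_l}) λ'_l(y_{n_l}) or just λ_l(x_{m_l})
    data Tail : Set where
      full : Λ → Λ → ℕ → ℕ → Tail
      half : Λ → ℕ → Tail

    tailλ : Tail → Λ
    tailλ (full l _ _ _) = l
    tailλ (half l _) = l

    tailm : Tail → ℕ
    tailm (full _ _ m _) = m
    tailm (half _ m) = m

    firstm : List Block → Tail → ℕ
    firstm [] t = tailm t
    firstm (blk _ _ m _ ∷ _) t = m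

    OrderedT : Tail → Set
    OrderedT (full _ _ m n) = m ≤ n
    OrderedT (half _ _) = ⊤

    Ordered : List Block → Tail → Set
    Ordered [] t = OrderedT t
    Ordered (blk _ _ m n ∷ bs) t = m ≤ n × n < firstm bs t × Ordered bs t

    tailTerms : (ℕ → X) → (ℕ → X) → Tail → Maybe Carrier × List (Maybe Carrier)
    tailTerms x y (full l l' m n) = lam l (x m) , (lam l' (y n) ∷ [])
    tailTerms x y (half l m) = lam l (x m) , []

    terms : (ℕ → X) → (ℕ → X) → List Block → Tail → Maybe Carrier × List (Maybe Carrier)
    terms x y [] t = tailTerms x y t
    terms x y (blk l l' m n ∷ bs) t =
      lam l (x m) , (lam l' (y n) ∷ (proj₁ (terms x y bs t) ∷ proj₂ (terms x y bs t)))

    element : (ℕ → X) → (ℕ → X) → List Block → Tail → Maybe Carrier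
    element x y bs t = pprod (proj₁ (terms x y bs t)) (proj₂ (terms x y bs t))

    module _ {A : Set} (_∨_ : A → A → A) (α : Λ → A) where

      ConjT : Tail → Set
      ConjT (full l l' _ _) = α l ≡ α l'
      ConjT (half _ _) = ⊤

      Conj : List Block → Tail → Set
      Conj bs t = All (λ b → α (Block.l b) ≡ α (Block.l' b)) bs × ConjT t

      join : List Block → Tail → A
      join [] t = α (tailλ t)
      join (b ∷ bs) t = α (Block.l b) ∨ join bs t

      SuffixesIn : List A → List Block → Tail → Set
      SuffixesIn F [] t = join [] t ∈ F
      SuffixesIn F (b ∷ bs) t = join (b ∷ bs) t ∈ F × SuffixesIn F bs t

      Admissible : List A → List Block → Tail → Set
      Admissible F bs t = Ordered bs t × Conj bs t × SuffixesIn F bs t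

      ConjTame : (F : List A) → ∀ {r} → (Carrier → Fin r) → (ℕ → X) → (ℕ → X) → Set
      ConjTame F c x y =
        ∀ bs t bs' t' → Admissible F bs t → Admissible F bs' t' →
        join bs t ≡ join bs' t' →
        ∀ s s' → element x y bs t ≡ just s → element x y bs' t' ≡ just s' →
        c s ≡ c s'

      record Hom (isSg : IsSemigroup _≡_ _∨_) : Set₁ where
        field
          f    : ⊤ → γX
          g    : A → γS
          g-hom : ∀ a b → mem (γS.ult (g (a ∨ b))) ≐ (mem (γS.ult (g a)) ⊛ mem (γS.ult (g b)))
          compat : ∀ (l : Λ) (pt : ⊤) →
            ext l (mem (γX.ult (f pt))) ≐ mem (γS.ult (g (α l)))

-- The points x₀, y₀, x₁, y₁, … are chosen greedily, alternately in members of
-- f(•) and of v.  Each choice must lie in every set λ⁻¹(B) that is large for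
-- the relevant ultrafilter, for the finitely many B determined by the products
-- K already fixed, the colours, λ, λ′ and the joins in F.  Tameness is then
-- proved block by block: if the colour class i is g(λ₀(•) ∨ ⋯ ∨ λₗ(•))-large
-- after K, then g(a ∨ b) = g(a) * g(b), λ(f(•)) * λ′(v) = λ(f(•)) and
-- λ(•) = λ′(•) let x_m and then y_n keep the class large after K λ(x_m) λ′(y_n).
-- Basicness comes from also requiring that every product already formed stays
-- defined when multiplied by λ(z).  Excluded middle is used to pick points of
-- large sets and to decide largeness.
module Submission where

open import Defs
open import Level using (0ℓ)
open import Axiom.ExcludedMiddle using (ExcludedMiddle)
open import Function using (_∘_)
open import Data.Nat
  using (ℕ; zero; suc; _≤_; _<_; z≤n; s≤s; _≤′_; ≤′-refl; ≤′-step)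
open import Data.Nat.Properties using (≤⇒≤′)
open import Data.Fin using (Fin)
open import Data.Unit using (tt)
open import Data.Empty using (⊥-elim)
open import Data.Product using (∃; ∃₂; _×_; Σ; _,_; proj₁; proj₂)
open import Data.Sum using (inj₁; inj₂)
open import Data.List using (List; []; _∷_; _++_; map; allFin; cartesianProductWith)
open import Data.List.Membership.Propositional using (_∈_)
open import Data.List.Membership.Propositional.Properties
  using (∈-++⁺ʳ; ∈-map⁺; ∈-allFin; ∈-cartesianProductWith⁺)
open import Data.List.Relation.Binary.Subset.Propositional using (_⊆_)
open import Data.List.Relation.Binary.Subset.Propositional.Properties using (xs⊆xs++ys)
open import Data.List.Relation.Unary.Any using (here; there)
open import Data.List.Relation.Unary.All using (_∷_)
open import Data.List.Relation.Unary.Linked using (Linked; _∷_)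
open import Data.Maybe using (Maybe; just; nothing; Is-just; _>>=_)
open import Data.Maybe.Relation.Unary.Any using (just)
open import Data.Maybe.Properties using (just-injective)
open import Relation.Nullary using (¬_; yes; no)
open import Relation.Binary.PropositionalEquality using (_≡_; refl; sym; trans; cong; subst)
open import Algebra.Structures using (IsSemigroup)

module _ {Y : Set} (U : Ultrafilter Y) where

  Generic : (Y → Set) → Y → Set
  Generic B y = mem U B → B y

  mem-∀∈ : {I : Set} (L : List I) (B : I → Y → Set) →
           (∀ a → a ∈ L → mem U (B a)) → mem U (λ y → ∀ a → a ∈ L → B a y)
  mem-∀∈ [] B _ = upward U (λ _ _ _ ()) (whole U)
  mem-∀∈ (a ∷ L) B large =
    upward U (λ { y (Ba , _) _ (here refl) → Ba ; y (_ , BL) b (there b∈L) → BL b b∈L })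
      (inter U (large a (here refl)) (mem-∀∈ L B (λ b b∈L → large b (there b∈L))))

  mem-∀Fin : ∀ {n} (B : Fin n → Y → Set) →
             (∀ i → mem U (B i)) → mem U (λ y → ∀ i → B i y)
  mem-∀Fin {n} B large =
    upward U (λ y B∀ i → B∀ i (∈-allFin i)) (mem-∀∈ (allFin n) B (λ i _ → large i))

  mem-fiber : {I : Set} (c : Y → I) (L : List I) →
              mem U (λ y → c y ∈ L) → ∃ λ i → mem U (λ y → c y ≡ i)
  mem-fiber c [] large = ⊥-elim (proper U (upward U (λ _ ()) large))
  mem-fiber c (i ∷ L) large with ultra U (λ y → c y ≡ i)
  ... | inj₁ fiber = i , fiber
  ... | inj₂ notFiber = mem-fiber c L (upward U drop (inter U large notFiber))
    where
      drop : ∀ y → c y ∈ i ∷ L × ¬ c y ≡ i → c y ∈ L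
      drop y (here eq , ne) = ⊥-elim (ne eq)
      drop y (there c∈L , _) = c∈L

  monochromatic : ∀ {r} (c : Y → Fin r) → ∃ λ i → mem U (λ y → c y ≡ i)
  monochromatic {r} c = mem-fiber c (allFin r) (upward U (λ y _ → ∈-allFin (c y)) (whole U))

  module _ (em : ExcludedMiddle 0ℓ) where

    choose : ∀ {B : Y → Set} → mem U B → Σ Y B
    choose {B} large with em {Σ Y B}
    ... | yes b = b
    ... | no ¬b = ⊥-elim (proper U (upward U (λ y By → ¬b (y , By)) large))

    generic-large : (B : Y → Set) → mem U (Generic B)
    generic-large B with em {mem U B}
    ... | yes large = upward U (λ _ By _ → By) large
    ... | no small = upward U (λ _ _ large → ⊥-elim (small large)) (whole U)

⊆-chain : {B : Set} (L : ℕ → List B) → (∀ j → L j ⊆ L (suc j)) →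
          ∀ {j j'} → j ≤ j' → L j ⊆ L j'
⊆-chain L step j≤j' = go (≤⇒≤′ j≤j')
  where
    go : ∀ {j j'} → j ≤′ j' → L j ⊆ L j'
    go ≤′-refl b∈ = b∈
    go (≤′-step p) = step _ ∘ go p

extend : ∀ {B : Set} {n} → List B → (B → Fin n → B) → List B
extend {n = n} bs op = bs ++ cartesianProductWith op bs (allFin n)

extend-∈ : ∀ {B : Set} {n} {b : B} {bs} (op : B → Fin n → B) →
           b ∈ bs → ∀ l → op b l ∈ extend bs op
extend-∈ {bs = bs} op b∈ l = ∈-++⁺ʳ bs (∈-cartesianProductWith⁺ op b∈ (∈-allFin l))

double : ℕ → ℕ
double zero = zero
double (suc n) = suc (suc (double n))

double-mono : ∀ {m n} → m ≤ n → double m ≤ double n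
double-mono z≤n = z≤n
double-mono (s≤s m≤n) = s≤s (s≤s (double-mono m≤n))

interleave-evens-odds : (S : PartialSemigroup) {Λ X : Set} (𝒮 : FunctionArray S Λ X)
  (z : ℕ → X) → ∀ j →
  interleave S 𝒮 (λ n → z (double n)) (λ n → z (suc (double n))) j ≡ z j
interleave-evens-odds S 𝒮 z zero = refl
interleave-evens-odds S 𝒮 z (suc zero) = refl
interleave-evens-odds S 𝒮 z (suc (suc j)) =
  interleave-evens-odds S 𝒮 (λ k → z (suc (suc k))) j

>>=-Is-just : ∀ {B C : Set} (mb : Maybe B) (f : B → Maybe C) →
              Is-just (mb >>= f) → Is-just mb
>>=-Is-just (just _) f _ = just tt

module PartialProducts (S : PartialSemigroup) where
  open PartialSemigroup S

  _·ᵐ_ : Maybe Carrier → Maybe Carrier → Maybe Carrier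
  ma ·ᵐ mb = ma >>= λ a → mb >>= λ b → a · b

  -- Here nothing is the empty prefix, not an undefined product.
  _⊙_ : Maybe Carrier → Maybe Carrier → Maybe Carrier
  nothing ⊙ mb = mb
  just a ⊙ mb = _·?_ S a mb

  ⊙-·ᵐ-defined : ∀ mu ma mb → Is-just (mu ⊙ ma) → Is-just ((mu ⊙ ma) ⊙ mb) →
                 Is-just (mu ⊙ (ma ·ᵐ mb))
  ⊙-·ᵐ-defined nothing (just a) mb _ defined = defined
  ⊙-·ᵐ-defined (just u) (just a) mb _ defined with u · a in ua≡
  ... | just ua with mb
  ...   | just b =
    subst Is-just (trans (cong (λ q → q >>= λ st → st · b) (sym ua≡)) (assoc u a b))
      defined

  -- Left multiplication by an already fixed product, kept unevaluated.
  Prefix : Set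
  Prefix = Maybe Carrier → Maybe Carrier

  infixl 5 _▸_
  _▸_ : Prefix → Maybe Carrier → Prefix
  (K ▸ ma) mb = K (ma ·ᵐ mb)

  module _ {r : ℕ} (c : Carrier → Fin r) where

    Coloured : Prefix → Fin r → Carrier → Set
    Coloured K i u = Σ Carrier λ w → (K (just u) ≡ just w) × (c w ≡ i)

    Coloured-transport : ∀ K K' {i u u'} → K (just u) ≡ K' (just u') →
                         Coloured K i u → Coloured K' i u'
    Coloured-transport _ _ eq (w , Ku≡w , cw) = w , trans (sym eq) Ku≡w , cw

    Coloured⇒colour : ∀ K {i mu s} →
                      Σ Carrier (λ u → (mu ≡ just u) × Coloured K i u) →
                      K mu ≡ just s → c s ≡ i
    Coloured⇒colour _ (u , refl , (w , Ku≡w , cw)) Ku≡s =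
      trans (cong c (just-injective (trans (sym Ku≡s) Ku≡w))) cw

module Construction
  (em : ExcludedMiddle 0ℓ)
  {k : ℕ} {A : Set} {_∨_ : A → A → A} {isSg : IsSemigroup _≡_ _∨_}
  {α : Fin k → A} {S : PartialSemigroup} {X : Set} {𝒮 : FunctionArray S (Fin k) X}
  (h : Hom S 𝒮 _∨_ α isSg) (v : γX S 𝒮)
  (idem : ∀ (l : Fin k) →
    _⊛_ S (ext S 𝒮 l (mem (γX.ult (Hom.f h tt)))) (ext S 𝒮 l (mem (γX.ult v)))
      ≐ ext S 𝒮 l (mem (γX.ult (Hom.f h tt))))
  (F : List A) (D : X → Set) (D∈f : mem (γX.ult (Hom.f h tt)) D)
  (E : X → Set) (E∈v : mem (γX.ult v) E)
  {r : ℕ} (c : PartialSemigroup.Carrier S → Fin r) where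

  open PartialSemigroup S
  open FunctionArray 𝒮
  open PartialProducts S

  𝔣 𝔳 : Ultrafilter X
  𝔣 = γX.ult (Hom.f h tt)
  𝔳 = γX.ult v

  𝔊 : A → Ultrafilter Carrier
  𝔊 a = γS.ult (Hom.g h a)

  𝔤 : A → Fam Carrier
  𝔤 a = mem (𝔊 a)

  lam⁻¹ : Fin k → (Carrier → Set) → X → Set
  lam⁻¹ l B x = Σ Carrier λ u → (lam l x ≡ just u) × B u

  lam⁻¹-map : ∀ {l B C x} → (∀ u → B u → C u) → lam⁻¹ l B x → lam⁻¹ l C x
  lam⁻¹-map B⊆C (u , lx≡u , Bu) = u , lx≡u , B⊆C u Bu

  fromG : ∀ l {B} → 𝔤 (α l) B → mem 𝔣 (lam⁻¹ l B)
  fromG l {B} = proj₂ (Hom.compat h l tt B)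

  toG : ∀ l {B} → mem 𝔣 (lam⁻¹ l B) → 𝔤 (α l) B
  toG l {B} = proj₁ (Hom.compat h l tt B)

  -- By definition of *, B ∈ λ(f(•)) * λ′(v) iff lam⁻¹ l (VShift l′ B) ∈ f(•).
  VShift : Fin k → (Carrier → Set) → Carrier → Set
  VShift l' B s = mem 𝔳 (lam⁻¹ l' (λ t → Σ Carrier λ u → (s · t ≡ just u) × B u))

  shift-large : ∀ {l l' B} → α l ≡ α l' →
                𝔤 (α l) B → mem 𝔣 (lam⁻¹ l (VShift l' B))
  shift-large {l} {l'} {B} eq g =
    fromG l (subst (λ a → 𝔤 a (VShift l' B)) (sym eq) (toG l' shifted))
    where
      shifted : mem 𝔣 (lam⁻¹ l' (VShift l' B))
      shifted = proj₂ (idem l' B) (fromG l' (subst (λ a → 𝔤 a B) eq g))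

  -- ob = just b means that further blocks follow, with join b.
  Completable : Prefix → Fin r → Maybe A → Carrier → Set
  Completable K i nothing = Coloured c K i
  Completable K i (just b) u = 𝔤 b (Coloured c (K ▸ just u) i)

  join-split : ∀ {a b K i} →
               𝔤 (a ∨ b) (Coloured c K i) → 𝔤 a (Completable K i (just b))
  join-split {a} {b} {K} g =
    upward (𝔊 a) (λ s → upward (𝔊 b) λ w (u , sw≡u , col) →
                    Coloured-transport c K (K ▸ just s) (cong K (sym sw≡u)) col)
      (proj₁ (Hom.g-hom h a b _) g)

  completable-reassoc : ∀ {K i} ob {s t u} → s · t ≡ just u →
    Completable K i ob u → Completable (K ▸ just s) i ob t
  completable-reassoc {K} nothing {s} st≡u =
    Coloured-transport c K (K ▸ just s) (cong K (sym st≡u))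
  completable-reassoc {K} (just b) {s} {t} {u} st≡u =
    upward (𝔊 b) λ w → Coloured-transport c (K ▸ just u) (K ▸ just s ▸ just t)
      (cong K (trans (cong (λ q → q >>= λ st → st · w) (sym st≡u)) (assoc s t w)))

  completable-▸ : ∀ {K i b mb} →
                  Σ Carrier (λ u → (mb ≡ just u) × Completable K i (just b) u) →
                  𝔤 b (Coloured c (K ▸ mb) i)
  completable-▸ (_ , refl , g) = g

  targets : List (Maybe A)
  targets = nothing ∷ map just F

  join∈F : ∀ bs t → SuffixesIn S 𝒮 _∨_ α F bs t → join S 𝒮 _∨_ α bs t ∈ F
  join∈F [] t j∈F = j∈F
  join∈F (b ∷ bs) t (j∈F , _) = j∈F

  Cond : Ultrafilter X → Prefix → X → Set
  Cond U K x = ∀ i l ob → ob ∈ targets →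
    Generic U (lam⁻¹ l (Completable K i ob)) x ×
    (∀ l' → Generic U (lam⁻¹ l (VShift l' (Completable K i ob))) x)

  Defined : List (Maybe Carrier) → X → Set
  Defined us x = ∀ mu → mu ∈ us → ∀ l → Is-just (mu ⊙ lam l x)

  record Stage : Set where
    constructor ⟨_,_⟩
    field
      prefixes : List (Prefix)
      products : List (Maybe Carrier)
  open Stage

  after : X → Stage → Stage
  after x s = ⟨ extend (prefixes s) (λ K l → K ▸ lam l x)
              , extend (products s) (λ mu l → mu ⊙ lam l x) ⟩

  data Side : Set where
    xSide ySide : Side

  point : Side → γX S 𝒮
  point xSide = Hom.f h tt
  point ySide = v

  Large : Side → X → Set
  Large xSide = D
  Large ySide = E

  record Good (σ : Side) (s : Stage) (x : X) : Set where
    field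
      isLarge : Large σ x
      defined : Defined (products s) x
      decides : ∀ K → K ∈ prefixes s → Cond (γX.ult (point σ)) K x

  large : ∀ σ → mem (γX.ult (point σ)) (Large σ)
  large xSide = D∈f
  large ySide = E∈v

  module _ (σ : Side) where
    private
      U = γX.ult (point σ)

    lam-defined : ∀ l → mem U (λ x → Is-just (lam l x))
    lam-defined l = upward U (λ x → >>=-Is-just (lam l x) _) (γX.adq (point σ) s₀ l)
      where
        s₀ : Carrier
        s₀ = proj₁ (proj₂ (choose 𝔣 em (fromG l (whole (𝔊 (α l))))))

    defined-large : ∀ us → mem U (Defined us)
    defined-large us = mem-∀∈ U us _ λ mu _ → mem-∀Fin U _ (prefix-defined mu)
      where
        prefix-defined : ∀ mu l → mem U (λ x → Is-just (mu ⊙ lam l x))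
        prefix-defined nothing = lam-defined
        prefix-defined (just u) = γX.adq (point σ) u

    cond-large : ∀ K → mem U (Cond U K)
    cond-large K =
      mem-∀Fin U _ λ i → mem-∀Fin U _ λ l → mem-∀∈ U targets _ λ ob _ →
      inter U (generic-large U em _) (mem-∀Fin U _ λ l' → generic-large U em _)

    good-large : ∀ s → mem U (Good σ s)
    good-large s =
      upward U (λ x (L , d , k) → record { isLarge = L ; defined = d ; decides = k })
        (inter U (large σ) (inter U (defined-large (products s))
          (mem-∀∈ U (prefixes s) _ λ K _ → cond-large K)))

  pick : Side → Stage → X
  pick σ s = proj₁ (choose (γX.ult (point σ)) em (good-large σ s))

  sideAt : ℕ → Side
  sideAt zero = xSide
  sideAt (suc zero) = ySide
  sideAt (suc (suc j)) = sideAt j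

  stage : ℕ → Stage
  stage zero = ⟨ (λ mb → mb) ∷ [] , nothing ∷ [] ⟩
  stage (suc j) = after (pick (sideAt j) (stage j)) (stage j)

  z : ℕ → X
  z j = pick (sideAt j) (stage j)

  xs ys : ℕ → X
  xs n = z (double n)
  ys n = z (suc (double n))

  z-good : ∀ j → Good (sideAt j) (stage j) (z j)
  z-good j = proj₂ (choose (γX.ult (point (sideAt j))) em (good-large (sideAt j) (stage j)))

  sideAt-double : ∀ n → sideAt (double n) ≡ xSide
  sideAt-double zero = refl
  sideAt-double (suc n) = sideAt-double n

  sideAt-suc-double : ∀ n → sideAt (suc (double n)) ≡ ySide
  sideAt-suc-double zero = refl
  sideAt-suc-double (suc n) = sideAt-suc-double n

  xs-good : ∀ n → Good xSide (stage (double n)) (xs n)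
  xs-good n =
    subst (λ σ → Good σ (stage (double n)) (xs n)) (sideAt-double n) (z-good (double n))

  ys-good : ∀ n → Good ySide (stage (suc (double n))) (ys n)
  ys-good n = subst (λ σ → Good σ (stage (suc (double n))) (ys n))
                    (sideAt-suc-double n) (z-good (suc (double n)))

  prefixes-mono : ∀ {j j'} → j ≤ j' → prefixes (stage j) ⊆ prefixes (stage j')
  prefixes-mono = ⊆-chain (λ j → prefixes (stage j)) (λ j → xs⊆xs++ys _ _)

  products-mono : ∀ {j j'} → j ≤ j' → products (stage j) ⊆ products (stage j')
  products-mono = ⊆-chain (λ j → products (stage j)) (λ j → xs⊆xs++ys _ _)

  ▸-prefix : ∀ {K} j → K ∈ prefixes (stage j) →
             ∀ l → K ▸ lam l (z j) ∈ prefixes (stage (suc j))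
  ▸-prefix _ = extend-∈ _

  x-prefix : ∀ {K m n} → K ∈ prefixes (stage (double m)) → m ≤ n → ∀ l →
             K ▸ lam l (xs m) ∈ prefixes (stage (suc (double n)))
  x-prefix {m = m} K∈ m≤n l =
    prefixes-mono (s≤s (double-mono m≤n)) (▸-prefix (double m) K∈ l)

  x-then-y : ∀ {K i ob l l' m n} →
    K ∈ prefixes (stage (double m)) → m ≤ n → ob ∈ targets → α l ≡ α l' →
    𝔤 (α l) (Completable K i ob) →
    lam⁻¹ l' (Completable (K ▸ lam l (xs m)) i ob) (ys n)
  x-then-y {K} {i} {ob} {l} {l'} {m} {n} K∈ m≤n ob∈ eq g =
    Good.decides (ys-good n) _ (x-prefix K∈ m≤n l) i l' ob ob∈ .proj₁ (y-large x-generic)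
    where
      x-generic : lam⁻¹ l (VShift l' (Completable K i ob)) (xs m)
      x-generic = Good.decides (xs-good m) K K∈ i l ob ob∈ .proj₂ l' (shift-large eq g)

      y-large : lam⁻¹ l (VShift l' (Completable K i ob)) (xs m) →
                mem 𝔳 (lam⁻¹ l' (Completable (K ▸ lam l (xs m)) i ob))
      y-large (s , lx≡s , shifted) =
        subst (λ a → mem 𝔳 (lam⁻¹ l' (Completable (K ▸ a) i ob))) (sym lx≡s)
          (upward 𝔳 (λ _ → lam⁻¹-map λ _ (_ , st≡u , comp) →
                            completable-reassoc ob st≡u comp)
            shifted)

  element-colour : ∀ bs t → Admissible S 𝒮 _∨_ α F bs t →
    ∀ {K i} → K ∈ prefixes (stage (double (firstm S 𝒮 bs t))) →
    𝔤 (join S 𝒮 _∨_ α bs t) (Coloured c K i) →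
    ∀ {s} → K (element S 𝒮 xs ys bs t) ≡ just s → c s ≡ i
  element-colour [] (half l m) _ {K} {i} K∈ g =
    Coloured⇒colour c K
      (Good.decides (xs-good m) K K∈ i l nothing (here refl) .proj₁ (fromG l g))
  element-colour [] (full l l' m n) (m≤n , (_ , eq) , _) {K} K∈ g =
    Coloured⇒colour c (K ▸ lam l (xs m)) (x-then-y K∈ m≤n (here refl) eq g)
  element-colour (blk l l' m n ∷ bs) t
      ((m≤n , n<m' , ord) , (eq ∷ conj , conjT) , (_ , suf)) {K} K∈ g =
    element-colour bs t (ord , (conj , conjT) , suf) K'∈
      (completable-▸ {K = K ▸ lam l (xs m)} y-generic)
    where
      y-generic = x-then-y K∈ m≤n (there (∈-map⁺ just (join∈F bs t suf))) eq
                    (join-split {K = K} g)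
      K'∈ = prefixes-mono (double-mono n<m')
              (▸-prefix (suc (double n)) (x-prefix K∈ m≤n l) l')

  conjugate-tame : ConjTame S 𝒮 _∨_ α F c xs ys
  conjugate-tame bs t bs' t' adm adm' same s s' e e' =
    trans (element-colour bs t adm (start bs t) class e)
          (sym (element-colour bs' t' adm' (start bs' t') class' e'))
    where
      start : ∀ bs t → (λ mb → mb) ∈ prefixes (stage (double (firstm S 𝒮 bs t)))
      start bs t = prefixes-mono {j' = double (firstm S 𝒮 bs t)} z≤n (here refl)

      colour = monochromatic (𝔊 (join S 𝒮 _∨_ α bs t)) c

      class : 𝔤 (join S 𝒮 _∨_ α bs t) (Coloured c (λ mb → mb) (proj₁ colour))
      class = upward (𝔊 _) (λ u cu → u , refl , cu) (proj₂ colour)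

      class' : 𝔤 (join S 𝒮 _∨_ α bs' t') (Coloured c (λ mb → mb) (proj₁ colour))
      class' = subst (λ a → 𝔤 a (Coloured c (λ mb → mb) (proj₁ colour))) same class

  products-defined : (tm : Fin k × ℕ → Maybe Carrier) →
    (∀ l p → tm (l , p) ≡ lam l (z p)) →
    ∀ w ws → Linked (λ a b → proj₂ a < proj₂ b) (w ∷ ws) →
    ∀ mu → mu ∈ products (stage (proj₂ w)) → Is-just (mu ⊙ pprod S (tm w) (map tm ws))
  products-defined tm tm≡ (l , p) [] _ mu mu∈
    rewrite tm≡ l p = Good.defined (z-good p) mu mu∈ l
  products-defined tm tm≡ (l , p) (w' ∷ ws) (p<p' ∷ linked) mu mu∈
    rewrite tm≡ l p =
      ⊙-·ᵐ-defined mu (lam l (z p)) _ (Good.defined (z-good p) mu mu∈ l)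
        (products-defined tm tm≡ w' ws linked _ (products-mono p<p' (extend-∈ _ mu∈ l)))

  basic : BasicDouble S 𝒮 xs ys
  basic w ws linked =
    products-defined _ (λ l p → cong (lam l) (interleave-evens-odds S 𝒮 z p)) w ws linked
      nothing (products-mono {j' = proj₂ w} z≤n (here refl))

corollary3p5 : ExcludedMiddle 0ℓ →
    (m : ℕ)
    (A : Set) (_∨_ : A → A → A) (isSg : IsSemigroup _≡_ _∨_)
    (α : Fin m → A)
    (S : PartialSemigroup) (X : Set) (𝒮 : FunctionArray S (Fin m) X)
    (h : Hom S 𝒮 _∨_ α isSg)
    (v : γX S 𝒮) →
    (∀ (l : Fin m) →
      _⊛_ S (ext S 𝒮 l (mem (γX.ult (Hom.f h tt)))) (ext S 𝒮 l (mem (γX.ult v)))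
        ≐ ext S 𝒮 l (mem (γX.ult (Hom.f h tt)))) →
    (F : List A) (D : X → Set) → mem (γX.ult (Hom.f h tt)) D →
    (E : X → Set) → mem (γX.ult v) E →
    (r : ℕ) (c : PartialSemigroup.Carrier S → Fin r) →
    ∃₂ λ (x y : ℕ → X) →
      BasicDouble S 𝒮 x y × (∀ n → D (x n)) × (∀ n → E (y n)) ×
      ConjTame S 𝒮 _∨_ α F c x y
corollary3p5 em m A _∨_ isSg α S X 𝒮 h v idem F D D∈f E E∈v r c =
  xs , ys , basic , (λ n → Good.isLarge (xs-good n)) , (λ n → Good.isLarge (ys-good n)) ,
  conjugate-tame
  where open Construction em h v idem F D D∈f E E∈v c
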